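{- Let $d\ge 6$ be an integer. Then $$M_{3,d}=\begin{cases} C^d_{3,d-3}, & 6\le d\le 9,\\ C^d_{3,d-2}, & d\ge 10.\end{cases}$$
   Context: For integers $i$ and $d$, let $c_i(z)=(z+i)(z+i-1)\cdots(z+i-(d-1))=d!\binom{z+i}{d}$, and let $C^d_{r,i}$ denote the coefficient of $z^r$ in $c_i(z)$, $0\le r\le d$. For $d\ge 3$, $M_{r,d}=\min\{C^d_{r,i}: 1\le i\le d-2\}$. -}

module Defs where

open import Data.Nat using (ℕ; zero; suc; _∸_)
open import Data.Integer using (ℤ; +_; _+_; _*_; _-_; _⊓_)
open import Data.List using (List; []; _∷_; foldr; map; upTo; lookup; length)

-- Polynomials over ℤ as coefficient lists, lowest degree first.
Poly : Set
Poly = List ℤ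

mulLin : ℤ → Poly → Poly
mulLin a []       = []
mulLin a (c ∷ cs) = (a * c) ∷ addShift c (mulLin a cs)
  where
  addShift : ℤ → Poly → Poly
  addShift c []       = c ∷ []
  addShift c (e ∷ es) = (c + e) ∷ es

-- c_i(z) = (z + i)(z + i - 1) ... (z + i - (d-1)), i an integer
cpoly : ℕ → ℤ → Poly
cpoly zero    i = + 1 ∷ []
cpoly (suc k) i = mulLin (i - + k) (cpoly k i)

-- coefficient of z^r in a polynomial (0 beyond its length)
coeff : ℕ → Poly → ℤ
coeff r       []       = + 0
coeff zero    (c ∷ cs) = c
coeff (suc r) (c ∷ cs) = coeff r cs

C : ℕ → ℕ → ℤ → ℤ
C d r i = coeff r (cpoly d i)

minC : ℕ → ℕ → ℕ → ℤ
minC d r zero          = C d r (+ 1)   -- unused for m = 0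
minC d r (suc zero)    = C d r (+ 1)
minC d r (suc (suc m)) = minC d r (suc m) ⊓ C d r (+ suc (suc m))

-- M_{r,d} = min { C^d_{r,i} : 1 ≤ i ≤ d-2 }  (meaningful for d ≥ 3)
M : ℕ → ℕ → ℤ
M r d = minC d r (d ∸ 2)

-- Only the coefficients of z⁰, …, z³ matter, so polynomials are handled through their
-- 3-jets and c_i is built one linear factor at a time.  Write d = n + 2 and 1 ≤ i ≤ n; the
-- factors of c_i are z + i, …, z + 1, z, z − 1, …, z − m with m = n + 1 − i.  Let p be the
-- jet of (z + 1)⋯(z + n).  Then
--   * c_n = (z² − z)·(z + 1)⋯(z + n), so C_{3,n} = p₁ − p₂;
--   * c_1 = (−1)ⁿ(z² + z)·p(−z), so C_{3,1} = ±(p₂ − p₁);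
--   * for 2 ≤ i ≤ n − 1, |C_{3,i}| ≤ w₃, the z³-coefficient of the envelope
--     z·(z + 1)⋯(z + i)·(z + 1)⋯(z + m) obtained by flipping the signs of the positive roots.
-- The core is the inequality w₃ + p₁ ≤ p₂ for n ≥ 15, proved by induction on m (it survives
-- multiplying both sides by linear factors), with base cases from an explicit estimate on the
-- rising product for large i and by evaluation for small i.  Hence C_{3,i} ≥ C_{3,n} and
-- M_{3,d} = C_{3,d−2} for d ≥ 17; the finitely many 6 ≤ d ≤ 16 are settled by evaluation.
module Submission where

open import Defs
open import Data.Nat using (ℕ; zero; suc; _≤_; _<_; _∸_; _+_; _*_; z≤n; s≤s; _≤?_)
open import Data.Nat.Properties
open import Data.Integer as ℤ using (ℤ; +_; -[1+_]; -_; ∣_∣)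
import Data.Integer.Properties as ℤᵖ
import Data.Integer.Tactic.RingSolver as ℤ-Ring
open import Data.List using ([]; _∷_)
open import Relation.Binary.PropositionalEquality
open import Data.Sum using (_⊎_; inj₁; inj₂)
open import Data.Product using (_×_; _,_; proj₂)
open import Data.Nat.Tactic.RingSolver using (solve-∀)
open import Relation.Nullary.Decidable using (Dec; yes; no; _×-dec_; toWitness; T?)
open import Data.Bool using (Bool; true; _∧_; T)
open import Data.Bool.Properties using (T-∧)
open import Function.Bundles using (Equivalence)

record Jet : Set where
  constructor ⟨_,_,_,_⟩
  field t₀ t₁ t₂ t₃ : ℤ
open Jet

jet-cong : ∀ {a b c d a′ b′ c′ d′} →
  a ≡ a′ → b ≡ b′ → c ≡ c′ → d ≡ d′ → ⟨ a , b , c , d ⟩ ≡ ⟨ a′ , b′ , c′ , d′ ⟩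
jet-cong refl refl refl refl = refl

jet : Poly → Jet
jet p = ⟨ coeff 0 p , coeff 1 p , coeff 2 p , coeff 3 p ⟩

mulJet : ℤ → Jet → Jet
mulJet a ⟨ x₀ , x₁ , x₂ , x₃ ⟩ =
  ⟨ a ℤ.* x₀ , a ℤ.* x₁ ℤ.+ x₀ , a ℤ.* x₂ ℤ.+ x₁ , a ℤ.* x₃ ℤ.+ x₂ ⟩

coeff-mulLin-zero : ∀ a p → coeff 0 (mulLin a p) ≡ a ℤ.* coeff 0 p
coeff-mulLin-zero a []      = sym (ℤᵖ.*-zeroʳ a)
coeff-mulLin-zero a (_ ∷ _) = refl

coeff-mulLin-suc : ∀ a p r →
  coeff (suc r) (mulLin a p) ≡ a ℤ.* coeff (suc r) p ℤ.+ coeff r p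
coeff-mulLin-suc a []           r       = sym (cong (ℤ._+ + 0) (ℤᵖ.*-zeroʳ a))
coeff-mulLin-suc a (c ∷ [])     zero    =
  sym (trans (cong (ℤ._+ c) (ℤᵖ.*-zeroʳ a)) (ℤᵖ.+-identityˡ c))
coeff-mulLin-suc a (c ∷ [])     (suc r) = sym (cong (ℤ._+ + 0) (ℤᵖ.*-zeroʳ a))
coeff-mulLin-suc a (c ∷ e ∷ es) zero    = ℤᵖ.+-comm c (a ℤ.* e)
coeff-mulLin-suc a (c ∷ e ∷ es) (suc r) = coeff-mulLin-suc a (e ∷ es) r

jet-mulLin : ∀ a p → jet (mulLin a p) ≡ mulJet a (jet p)
jet-mulLin a p = jet-cong (coeff-mulLin-zero a p) (coeff-mulLin-suc a p 0)
                          (coeff-mulLin-suc a p 1) (coeff-mulLin-suc a p 2)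

cjet : ℕ → ℤ → Jet
cjet zero    i = ⟨ + 1 , + 0 , + 0 , + 0 ⟩
cjet (suc k) i = mulJet (i ℤ.- + k) (cjet k i)

jet-cpoly : ∀ d i → jet (cpoly d i) ≡ cjet d i
jet-cpoly zero    i = refl
jet-cpoly (suc k) i = trans (jet-mulLin (i ℤ.- + k) (cpoly k i))
                            (cong (mulJet (i ℤ.- + k)) (jet-cpoly k i))

C≡cjet : ∀ d i → C d 3 i ≡ t₃ (cjet d i)
C≡cjet d i = cong t₃ (jet-cpoly d i)

mulJet-comm : ∀ a b t → mulJet a (mulJet b t) ≡ mulJet b (mulJet a t)
mulJet-comm a b ⟨ x₀ , x₁ , x₂ , x₃ ⟩ =
  jet-cong (lead a b x₀) (next a b x₀ x₁) (inner a b x₀ x₁ x₂) (inner a b x₁ x₂ x₃)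
  where
  lead : ∀ a b x → a ℤ.* (b ℤ.* x) ≡ b ℤ.* (a ℤ.* x)
  lead = ℤ-Ring.solve-∀
  next : ∀ a b x y → a ℤ.* (b ℤ.* y ℤ.+ x) ℤ.+ b ℤ.* x ≡ b ℤ.* (a ℤ.* y ℤ.+ x) ℤ.+ a ℤ.* x
  next = ℤ-Ring.solve-∀
  inner : ∀ a b x y z →
    a ℤ.* (b ℤ.* z ℤ.+ y) ℤ.+ (b ℤ.* y ℤ.+ x) ≡ b ℤ.* (a ℤ.* z ℤ.+ y) ℤ.+ (a ℤ.* y ℤ.+ x)
  inner = ℤ-Ring.solve-∀

record NJet : Set where
  constructor ⟪_,_,_,_⟫
  field w₀ w₁ w₂ w₃ : ℕ
open NJet

mulNJet : ℕ → NJet → NJet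
mulNJet k ⟪ x₀ , x₁ , x₂ , x₃ ⟫ = ⟪ k * x₀ , k * x₁ + x₀ , k * x₂ + x₁ , k * x₃ + x₂ ⟫

rising : ℕ → NJet
rising zero    = ⟪ 1 , 0 , 0 , 0 ⟫
rising (suc n) = mulNJet (suc n) (rising n)

toJet : NJet → Jet
toJet ⟪ x₀ , x₁ , x₂ , x₃ ⟫ = ⟨ + x₀ , + x₁ , + x₂ , + x₃ ⟩

toJet-mul : ∀ k w → toJet (mulNJet k w) ≡ mulJet (+ k) (toJet w)
toJet-mul k ⟪ x₀ , x₁ , x₂ , x₃ ⟫ =
  jet-cong (ℤᵖ.pos-* k x₀) (pos-linear x₀ x₁) (pos-linear x₁ x₂) (pos-linear x₂ x₃)
  where
  pos-linear : ∀ x y → + (k * y + x) ≡ + k ℤ.* + y ℤ.+ + x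
  pos-linear x y = cong (ℤ._+ + x) (ℤᵖ.pos-* k y)

cjet-shift : ∀ k i → cjet (suc k) (+ suc i) ≡ mulJet (+ suc i) (cjet k (+ i))
cjet-shift zero    i = cong (λ a → mulJet a (cjet 0 (+ i))) (ℤᵖ.+-identityʳ (+ suc i))
cjet-shift (suc k) i = begin
    mulJet (+ suc i ℤ.- + suc k) (cjet (suc k) (+ suc i))
  ≡⟨ cong (mulJet (+ suc i ℤ.- + suc k)) (cjet-shift k i) ⟩
    mulJet (+ suc i ℤ.- + suc k) (mulJet (+ suc i) (cjet k (+ i)))
  ≡⟨ mulJet-comm (+ suc i ℤ.- + suc k) (+ suc i) (cjet k (+ i)) ⟩
    mulJet (+ suc i) (mulJet (+ suc i ℤ.- + suc k) (cjet k (+ i)))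
  ≡⟨ cong (λ a → mulJet (+ suc i) (mulJet a (cjet k (+ i)))) (cancel-one (+ i) (+ k)) ⟩
    mulJet (+ suc i) (cjet (suc k) (+ i))
  ∎
  where
  open ≡-Reasoning
  cancel-one : ∀ x y → (+ 1 ℤ.+ x) ℤ.- (+ 1 ℤ.+ y) ≡ x ℤ.- y
  cancel-one = ℤ-Ring.solve-∀

cjet-diag : ∀ k → cjet k (+ k) ≡ toJet (rising k)
cjet-diag zero    = refl
cjet-diag (suc k) = begin
    cjet (suc k) (+ suc k)               ≡⟨ cjet-shift k k ⟩
    mulJet (+ suc k) (cjet k (+ k))      ≡⟨ cong (mulJet (+ suc k)) (cjet-diag k) ⟩
    mulJet (+ suc k) (toJet (rising k))  ≡⟨ toJet-mul (suc k) (rising k) ⟨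
    toJet (rising (suc k))               ∎
  where open ≡-Reasoning

sub-plus : ∀ x y → x ℤ.- (x ℤ.+ y) ≡ - y
sub-plus = ℤ-Ring.solve-∀

sub-plus′ : ∀ x y → x ℤ.- (y ℤ.+ x) ≡ - y
sub-plus′ = ℤ-Ring.solve-∀

-- Right endpoint: c_n with n + 2 factors is (z+1)⋯(z+n)·z·(z − 1),
-- so its z³-coefficient is p₁ − p₂ for p the jet of (z+1)⋯(z+n).
C-last : ∀ n → C (2 + n) 3 (+ n) ≡ + w₁ (rising n) ℤ.- + w₂ (rising n)
C-last n = begin
    C (2 + n) 3 (+ n)
  ≡⟨ C≡cjet (2 + n) (+ n) ⟩
    t₃ (mulJet (+ n ℤ.- + suc n) (mulJet (+ n ℤ.- + n) (cjet n (+ n))))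
  ≡⟨ cong₂ (λ a b → t₃ (mulJet a (mulJet b (cjet n (+ n)))))
           (sub-plus′ (+ n) (+ 1)) (ℤᵖ.+-inverseʳ (+ n)) ⟩
    t₃ (mulJet (- + 1) (mulJet (+ 0) (cjet n (+ n))))
  ≡⟨ cong (λ t → t₃ (mulJet (- + 1) (mulJet (+ 0) t))) (cjet-diag n) ⟩
    t₃ (mulJet (- + 1) (mulJet (+ 0) (toJet (rising n))))
  ≡⟨ times-z²-z (+ w₀ (rising n)) (+ w₁ (rising n)) (+ w₂ (rising n)) (+ w₃ (rising n)) ⟩
    + w₁ (rising n) ℤ.- + w₂ (rising n)
  ∎
  where
  open ≡-Reasoning
  times-z²-z : ∀ a b c d → (- + 1) ℤ.* (+ 0 ℤ.* d ℤ.+ c) ℤ.+ (+ 0 ℤ.* c ℤ.+ b) ≡ b ℤ.- c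
  times-z²-z = ℤ-Ring.solve-∀

sign : ℕ → ℤ
sign zero    = + 1
sign (suc k) = - sign k

sign-unit : ∀ k → sign k ≡ + 1 ⊎ sign k ≡ - + 1
sign-unit zero = inj₁ refl
sign-unit (suc k) with sign-unit k
... | inj₁ eq = inj₂ (cong -_ eq)
... | inj₂ eq = inj₁ (trans (cong -_ eq) (ℤᵖ.neg-involutive (+ 1)))

-- The jet of σ·(z² + z)·f(−z), given the jet of f.
twist : ℤ → Jet → Jet
twist σ ⟨ x₀ , x₁ , x₂ , _ ⟩ =
  ⟨ + 0 , σ ℤ.* x₀ , σ ℤ.* (x₀ ℤ.- x₁) , σ ℤ.* (x₂ ℤ.- x₁) ⟩

-- (z − a)·f(−z) = −((−z) + a)·f(−z), so the factor z − a moves inside the twist.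
twist-mul : ∀ σ a t → mulJet (- a) (twist σ t) ≡ twist (- σ) (mulJet a t)
twist-mul σ a ⟨ x₀ , x₁ , x₂ , x₃ ⟩ =
  jet-cong (zero-coeff a) (first σ a x₀) (middle σ a x₀ x₁) (last σ a x₀ x₁ x₂)
  where
  zero-coeff : ∀ a → (- a) ℤ.* + 0 ≡ + 0
  zero-coeff = ℤ-Ring.solve-∀
  first : ∀ σ a x → (- a) ℤ.* (σ ℤ.* x) ℤ.+ + 0 ≡ (- σ) ℤ.* (a ℤ.* x)
  first = ℤ-Ring.solve-∀
  middle : ∀ σ a x y → (- a) ℤ.* (σ ℤ.* (x ℤ.- y)) ℤ.+ σ ℤ.* x ≡ (- σ) ℤ.* (a ℤ.* x ℤ.- (a ℤ.* y ℤ.+ x))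
  middle = ℤ-Ring.solve-∀
  last : ∀ σ a x y z → (- a) ℤ.* (σ ℤ.* (z ℤ.- y)) ℤ.+ σ ℤ.* (x ℤ.- y)
                      ≡ (- σ) ℤ.* ((a ℤ.* z ℤ.+ y) ℤ.- (a ℤ.* y ℤ.+ x))
  last = ℤ-Ring.solve-∀

-- Left endpoint: c_1 with k + 2 factors is (z+1)·z·(z−1)⋯(z−k) = (−1)ᵏ(z² + z)·f(−z)
-- for f = (z+1)⋯(z+k).
cjet-first : ∀ k → cjet (2 + k) (+ 1) ≡ twist (sign k) (toJet (rising k))
cjet-first zero    = refl
cjet-first (suc k) = begin
    mulJet (+ 1 ℤ.- + suc (suc k)) (cjet (2 + k) (+ 1))
  ≡⟨ cong₂ mulJet (sub-plus (+ 1) (+ suc k)) (cjet-first k) ⟩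
    mulJet (- + suc k) (twist (sign k) (toJet (rising k)))
  ≡⟨ twist-mul (sign k) (+ suc k) (toJet (rising k)) ⟩
    twist (sign (suc k)) (mulJet (+ suc k) (toJet (rising k)))
  ≡⟨ cong (twist (sign (suc k))) (toJet-mul (suc k) (rising k)) ⟨
    twist (sign (suc k)) (toJet (rising (suc k)))
  ∎
  where open ≡-Reasoning

C-first : ∀ k → C (2 + k) 3 (+ 1) ≡ sign k ℤ.* (+ w₂ (rising k) ℤ.- + w₁ (rising k))
C-first k = trans (C≡cjet (2 + k) (+ 1)) (cong t₃ (cjet-first k))

_≼_ : Jet → NJet → Set
t ≼ w = ∣ t₀ t ∣ ≤ w₀ w × ∣ t₁ t ∣ ≤ w₁ w × ∣ t₂ t ∣ ≤ w₂ w × ∣ t₃ t ∣ ≤ w₃ w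

abs-scale : ∀ k y → ∣ (- + k) ℤ.* y ∣ ≡ k * ∣ y ∣
abs-scale k y = trans (ℤᵖ.abs-* (- + k) y) (cong (_* ∣ y ∣) (ℤᵖ.∣-i∣≡∣i∣ (+ k)))

abs-linear : ∀ k x y → ∣ (- + k) ℤ.* y ℤ.+ x ∣ ≤ k * ∣ y ∣ + ∣ x ∣
abs-linear k x y = ≤-trans (ℤᵖ.∣i+j∣≤∣i∣+∣j∣ ((- + k) ℤ.* y) x)
                           (≤-reflexive (cong (_+ ∣ x ∣) (abs-scale k y)))

≼-mul : ∀ k t w → t ≼ w → mulJet (- + k) t ≼ mulNJet k w
≼-mul k t w (h₀ , h₁ , h₂ , h₃) =
  ≤-trans (≤-reflexive (abs-scale k (t₀ t))) (*-monoʳ-≤ k h₀) ,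
  next h₀ h₁ , next h₁ h₂ , next h₂ h₃
  where
  next : ∀ {x y u v} → ∣ x ∣ ≤ u → ∣ y ∣ ≤ v → ∣ (- + k) ℤ.* y ℤ.+ x ∣ ≤ k * v + u
  next {x} {y} hx hy = ≤-trans (abs-linear k x y) (+-mono-≤ (*-monoʳ-≤ k hy) hx)

shiftUp : NJet → NJet
shiftUp w = ⟪ 0 , w₀ w , w₁ w , w₂ w ⟫

-- The jet of z·(z+1)⋯(z+i)·(z+1)⋯(z+m).  Since c_i with m + i + 1 factors has
-- roots −i, …, −1, 0, 1, …, m, its coefficients are dominated by this one.
envelope : ℕ → ℕ → NJet
envelope i zero    = shiftUp (rising i)
envelope i (suc m) = mulNJet (suc m) (envelope i m)

-- With m = 0 this is the equality c_i = z·(z+1)⋯(z+i); each further factor z − m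
-- is dominated by z + m.
cjet-≼ : ∀ i m → cjet (suc (m + i)) (+ i) ≼ envelope i m
cjet-≼ i zero = subst (_≼ shiftUp (rising i)) middle-factor
  (≤-refl , ≤-refl , ≤-refl , ≤-refl)
  where
  middle-factor : mulJet (+ 0) (toJet (rising i)) ≡ cjet (suc i) (+ i)
  middle-factor = sym (cong₂ mulJet (ℤᵖ.+-inverseʳ (+ i)) (cjet-diag i))
cjet-≼ i (suc m) =
  subst (λ a → mulJet a (cjet (suc (m + i)) (+ i)) ≼ envelope i (suc m))
        (sym (sub-plus′ (+ i) (+ suc m)))
        (≼-mul (suc m) (cjet (suc (m + i)) (+ i)) (envelope i m) (cjet-≼ i m))

Ascending : NJet → Set
Ascending w = w₀ w ≤ w₁ w × w₁ w ≤ w₂ w × w₂ w ≤ w₃ w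

lead-≤ : ∀ k {x₀ x₁} → x₀ ≤ x₁ → k * x₀ ≤ k * x₁ + x₀
lead-≤ k h = ≤-trans (*-monoʳ-≤ k h) (m≤m+n _ _)

step-≤ : ∀ k {x₀ x₁ x₂} → x₀ ≤ x₁ → x₁ ≤ x₂ → k * x₁ + x₀ ≤ k * x₂ + x₁
step-≤ k h₀₁ h₁₂ = +-mono-≤ (*-monoʳ-≤ k h₁₂) h₀₁

ascending-mul : ∀ k w → Ascending w → Ascending (mulNJet k w)
ascending-mul k w (h₀₁ , h₁₂ , h₂₃) = lead-≤ k h₀₁ , step-≤ k h₀₁ h₁₂ , step-≤ k h₁₂ h₂₃

-- (z+1)⋯(z+n) has p₀ = n! ≤ n!·(1 + ⋯ + 1/n) = p₁.
rising-lead : ∀ {n} → 1 ≤ n → w₀ (rising n) ≤ w₁ (rising n)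
rising-lead {suc zero}    _ = ≤-refl
rising-lead {suc (suc n)} _ = lead-≤ (suc (suc n)) (rising-lead {suc n} (s≤s z≤n))

-- The envelope w of c_i stays below the jet a of (z+1)⋯(z+n) in the sense
-- w₃ + a₁ ≤ a₂; this is exactly what makes C_{3,i} ≥ C_{3,n}.
Gap : NJet → NJet → Set
Gap w a = w₃ w + w₁ a ≤ w₂ a

gap-mul : ∀ {k n} w a → k ≤ n → w₂ w ≤ w₃ w → w₀ a ≤ w₁ a → Gap w a →
          Gap (mulNJet k w) (mulNJet (suc n) a)
gap-mul {k} {n} ⟪ _ , _ , x₂ , x₃ ⟫ ⟪ a₀ , a₁ , a₂ , _ ⟫ k≤n h₂₃ h₀₁ gap = begin
  (k * x₃ + x₂) + (suc n * a₁ + a₀)  ≤⟨ +-mono-≤ (+-mono-≤ (*-monoˡ-≤ x₃ k≤n) h₂₃)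
                                                 (+-monoʳ-≤ (suc n * a₁) h₀₁) ⟩
  (n * x₃ + x₃) + (suc n * a₁ + a₁)  ≡⟨ regroup n x₃ a₁ ⟩
  suc n * (x₃ + a₁) + a₁             ≤⟨ +-monoˡ-≤ a₁ (*-monoʳ-≤ (suc n) gap) ⟩
  suc n * a₂ + a₁                    ∎
  where
  open ≤-Reasoning
  regroup : ∀ n x a → (n * x + x) + ((1 + n) * a + a) ≡ (1 + n) * (x + a) + a
  regroup = solve-∀

Comparable : NJet → NJet → Set
Comparable w a = Ascending w × Gap w a

comparable? : ∀ w a → Dec (Comparable w a)
comparable? w a = ((w₀ w ≤? w₁ w) ×-dec (w₁ w ≤? w₂ w) ×-dec (w₂ w ≤? w₃ w))
                  ×-dec (w₃ w + w₁ a ≤? w₂ a)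

comparable-mono : ∀ {j m₀ m} → 1 ≤ j → m₀ ≤ m →
  Comparable (envelope (suc j) m₀) (rising (m₀ + j)) →
  Comparable (envelope (suc j) m) (rising (m + j))
comparable-mono {j} {m₀} {m} 1≤j m₀≤m base =
  subst (λ m → Comparable (envelope (suc j) m) (rising (m + j)))
        (m∸n+n≡m m₀≤m) (grow (m ∸ m₀))
  where
  grow : ∀ u → Comparable (envelope (suc j) (u + m₀)) (rising (u + m₀ + j))
  grow zero    = base
  grow (suc u) with grow u
  ... | asc , gap =
    ascending-mul (suc (u + m₀)) _ asc ,
    gap-mul (envelope (suc j) (u + m₀)) (rising (u + m₀ + j))
            (m<m+n (u + m₀) 1≤j) (proj₂ (proj₂ asc))
            (rising-lead (≤-trans 1≤j (m≤n+m j (u + m₀)))) gap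

Spread : ℕ → NJet → Set
Spread i p = (4 + i) * w₁ p + 2 * w₀ p ≤ i * w₂ p

spread⇒≤ : ∀ i p → Spread i p → w₁ p ≤ w₂ p
spread⇒≤ i p h = *-cancelˡ-≤ (4 + i) (begin
  (4 + i) * w₁ p               ≤⟨ m≤m+n _ _ ⟩
  (4 + i) * w₁ p + 2 * w₀ p    ≤⟨ h ⟩
  i * w₂ p                     ≤⟨ *-monoˡ-≤ (w₂ p) (m≤n+m i 4) ⟩
  (4 + i) * w₂ p               ∎)
  where open ≤-Reasoning

spread-mul : ∀ i p → w₀ p ≤ w₁ p → Spread i p → Spread (suc i) (mulNJet (2 + i) p)
spread-mul i ⟪ p₀ , p₁ , p₂ , _ ⟫ h₀₁ h = begin
  (5 + i) * ((2 + i) * p₁ + p₀) + 2 * ((2 + i) * p₀)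
    ≡⟨ regroup₁ i p₀ p₁ ⟩
  (5 + i) * ((2 + i) * p₁) + 2 * ((3 + i) * p₀) + (3 + i) * p₀
    ≤⟨ +-monoʳ-≤ ((5 + i) * ((2 + i) * p₁) + 2 * ((3 + i) * p₀)) (*-monoʳ-≤ (3 + i) h₀₁) ⟩
  (5 + i) * ((2 + i) * p₁) + 2 * ((3 + i) * p₀) + (3 + i) * p₁
    ≤⟨ m≤m+n _ (2 * p₂) ⟩
  (5 + i) * ((2 + i) * p₁) + 2 * ((3 + i) * p₀) + (3 + i) * p₁ + 2 * p₂
    ≡⟨ regroup₂ i p₀ p₁ p₂ ⟩
  (3 + i) * ((4 + i) * p₁ + 2 * p₀) + 2 * p₂ + (1 + i) * p₁
    ≤⟨ +-monoˡ-≤ _ (+-monoˡ-≤ _ (*-monoʳ-≤ (3 + i) h)) ⟩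
  (3 + i) * (i * p₂) + 2 * p₂ + (1 + i) * p₁
    ≡⟨ regroup₃ i p₁ p₂ ⟩
  (1 + i) * ((2 + i) * p₂ + p₁)
    ∎
  where
  open ≤-Reasoning
  regroup₁ : ∀ i p₀ p₁ → (5 + i) * ((2 + i) * p₁ + p₀) + 2 * ((2 + i) * p₀)
             ≡ (5 + i) * ((2 + i) * p₁) + 2 * ((3 + i) * p₀) + (3 + i) * p₀
  regroup₁ = solve-∀
  regroup₂ : ∀ i p₀ p₁ p₂ →
    (5 + i) * ((2 + i) * p₁) + 2 * ((3 + i) * p₀) + (3 + i) * p₁ + 2 * p₂
    ≡ (3 + i) * ((4 + i) * p₁ + 2 * p₀) + 2 * p₂ + (1 + i) * p₁
  regroup₂ = solve-∀
  regroup₃ : ∀ i p₁ p₂ → (3 + i) * (i * p₂) + 2 * p₂ + (1 + i) * p₁ ≡ (1 + i) * ((2 + i) * p₂ + p₁)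
  regroup₃ = solve-∀

spread-rising : ∀ {i} → 13 ≤ i → Spread i (rising (suc i))
spread-rising {i} 13≤i =
  subst (λ i → Spread i (rising (suc i))) (m∸n+n≡m 13≤i) (from-13 (i ∸ 13))
  where
  from-13 : ∀ u → Spread (u + 13) (rising (suc (u + 13)))
  from-13 zero    = ≤ᵇ⇒≤ _ _ _
  from-13 (suc u) = spread-mul (u + 13) (rising (suc (u + 13)))
                               (rising-lead {suc (u + 13)} (s≤s z≤n)) (from-13 u)

comparable-two : ∀ j p → w₀ p ≤ w₁ p → Spread j p →
  Comparable (mulNJet 2 (mulNJet 1 (shiftUp p))) (mulNJet (2 + j) p)
comparable-two j p@(⟪ p₀ , p₁ , p₂ , _ ⟫) h₀₁ h =
  ascending-mul 2 _ (ascending-mul 1 _ (z≤n , h₀₁ , spread⇒≤ j p h)) , gap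
  where
  open ≤-Reasoning
  regroup₁ : ∀ j p₀ p₁ p₂ → 2 * (1 * p₂ + p₁) + (1 * p₁ + p₀) + ((2 + j) * p₁ + p₀)
             ≡ 2 * p₂ + p₁ + ((4 + j) * p₁ + 2 * p₀)
  regroup₁ = solve-∀
  regroup₂ : ∀ j p₁ p₂ → 2 * p₂ + p₁ + j * p₂ ≡ (2 + j) * p₂ + p₁
  regroup₂ = solve-∀
  gap : Gap (mulNJet 2 (mulNJet 1 (shiftUp p))) (mulNJet (2 + j) p)
  gap = begin
    2 * (1 * p₂ + p₁) + (1 * p₁ + p₀) + ((2 + j) * p₁ + p₀) ≡⟨ regroup₁ j p₀ p₁ p₂ ⟩
    2 * p₂ + p₁ + ((4 + j) * p₁ + 2 * p₀)                   ≤⟨ +-monoʳ-≤ (2 * p₂ + p₁) h ⟩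
    2 * p₂ + p₁ + j * p₂                                    ≡⟨ regroup₂ j p₁ p₂ ⟩
    (2 + j) * p₂ + p₁                                       ∎

-- Base cases i = j + 2 ≤ 13, at m = 14 − j (so that n = 15), checked by evaluation.
comparable-small : ∀ {j} → j < 12 →
  Comparable (envelope (2 + j) (14 ∸ j)) (rising (14 ∸ j + suc j))
comparable-small = toWitness {a? = allUpTo? (λ j → comparable? (envelope (2 + j) (14 ∸ j))
                                                              (rising (14 ∸ j + suc j))) 12} _

comparable-all : ∀ j m → 1 ≤ j → 2 ≤ m → 15 ≤ m + j →
  Comparable (envelope (suc j) m) (rising (m + j))
comparable-all (suc j) m 1≤j 2≤m 15≤n with suc j ≤? 12
... | yes j<12 = comparable-mono 1≤j m₀≤m (comparable-small j<12)
  where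
  m₀≤m : 14 ∸ j ≤ m
  m₀≤m = ≤-trans (∸-monoˡ-≤ (suc j) 15≤n) (≤-reflexive (m+n∸n≡m m (suc j)))
... | no  j≮12 = comparable-mono 1≤j 2≤m
  (comparable-two (suc j) (rising (2 + j)) (rising-lead {2 + j} (s≤s z≤n)) (spread-rising (≰⇒> j≮12)))

extend : ∀ {P : ℕ → Set} {L} → (∀ i → 1 ≤ i → i ≤ L → P i) → P (suc L) →
         ∀ i → 1 ≤ i → i ≤ suc L → P i
extend below top i 1≤i i≤L+1 with m≤n⇒m<n∨m≡n i≤L+1
... | inj₁ (s≤s i≤L) = below i 1≤i i≤L
... | inj₂ refl      = top

minC-≤ : ∀ d r L i → 1 ≤ i → i ≤ L → minC d r L ℤ.≤ C d r (+ i)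
minC-≤ d r zero          (suc i)       _ ()
minC-≤ d r (suc zero)    (suc zero)    _ _ = ℤᵖ.≤-refl
minC-≤ d r (suc zero)    (suc (suc i)) _ (s≤s ())
minC-≤ d r (suc (suc L)) = extend
  (λ i 1≤i i≤L → ℤᵖ.≤-trans (ℤᵖ.i⊓j≤i _ _) (minC-≤ d r (suc L) i 1≤i i≤L))
  (ℤᵖ.i⊓j≤j _ _)

minC-≥ : ∀ d r L v → 1 ≤ L → (∀ i → 1 ≤ i → i ≤ L → v ℤ.≤ C d r (+ i)) → v ℤ.≤ minC d r L
minC-≥ d r zero          v () _
minC-≥ d r (suc zero)    v _ below = below 1 ≤-refl ≤-refl
minC-≥ d r (suc (suc L)) v _ below =
  ℤᵖ.⊓-glb (minC-≥ d r (suc L) v (s≤s z≤n) (λ i 1≤i i≤L → below i 1≤i (m≤n⇒m≤1+n i≤L)))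
           (below (suc (suc L)) (s≤s z≤n) ≤-refl)

minC-attained : ∀ d r L j → 1 ≤ j → j ≤ L →
  (∀ i → 1 ≤ i → i ≤ L → C d r (+ j) ℤ.≤ C d r (+ i)) → minC d r L ≡ C d r (+ j)
minC-attained d r L j 1≤j j≤L below =
  ℤᵖ.≤-antisym (minC-≤ d r L j 1≤j j≤L) (minC-≥ d r L (C d r (+ j)) (≤-trans 1≤j j≤L) below)

neg-abs-≤ : ∀ x → - + ∣ x ∣ ℤ.≤ x
neg-abs-≤ (+ _)    = ℤᵖ.neg-≤-pos
neg-abs-≤ -[1+ _ ] = ℤᵖ.≤-refl

gap-bound : ∀ x {w a b} → ∣ x ∣ ≤ w → w + a ≤ b → + a ℤ.- + b ℤ.≤ x
gap-bound x {w} {a} {b} ∣x∣≤w w+a≤b = begin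
  + a ℤ.- + b        ≤⟨ ℤᵖ.+-monoʳ-≤ (+ a) (ℤᵖ.neg-mono-≤ (ℤ.+≤+ w+a≤b)) ⟩
  + a ℤ.- + (w + a)  ≡⟨ sub-plus′ (+ a) (+ w) ⟩
  - + w              ≤⟨ ℤᵖ.neg-mono-≤ (ℤ.+≤+ ∣x∣≤w) ⟩
  - + ∣ x ∣          ≤⟨ neg-abs-≤ x ⟩
  x                  ∎
  where open ℤᵖ.≤-Reasoning

sign-bound : ∀ k {x y} → x ℤ.≤ y → x ℤ.- y ℤ.≤ sign k ℤ.* (y ℤ.- x)
sign-bound k {x} {y} x≤y with sign k | sign-unit k
... | _ | inj₁ refl = ℤᵖ.≤-trans (ℤᵖ.≤-trans (ℤᵖ.i≤j⇒i-j≤0 x≤y) (ℤᵖ.i≤j⇒0≤j-i x≤y))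
                                  (ℤᵖ.≤-reflexive (sym (ℤᵖ.*-identityˡ (y ℤ.- x))))
... | _ | inj₂ refl = ℤᵖ.≤-reflexive (flip x y)
  where
  flip : ∀ x y → x ℤ.- y ≡ (- + 1) ℤ.* (y ℤ.- x)
  flip = ℤ-Ring.solve-∀

-- Interior points i = j + 1 with 2 ≤ i ≤ n − 1, where n = m + j:
-- C_{3,i} ≥ −(envelope)₃ ≥ p₁ − p₂ = C_{3,n}.
C-interior : ∀ j m → 1 ≤ j → 2 ≤ m → 15 ≤ m + j →
  C (2 + (m + j)) 3 (+ (m + j)) ℤ.≤ C (2 + (m + j)) 3 (+ suc j)
C-interior j m 1≤j 2≤m 15≤n = begin
    C (2 + (m + j)) 3 (+ (m + j))
  ≡⟨ C-last (m + j) ⟩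
    + w₁ (rising (m + j)) ℤ.- + w₂ (rising (m + j))
  ≤⟨ gap-bound (t₃ (cjet (suc (m + suc j)) (+ suc j)))
               (proj₂ (proj₂ (proj₂ (cjet-≼ (suc j) m))))
               (proj₂ (comparable-all j m 1≤j 2≤m 15≤n)) ⟩
    t₃ (cjet (suc (m + suc j)) (+ suc j))
  ≡⟨ C≡cjet (suc (m + suc j)) (+ suc j) ⟨
    C (suc (m + suc j)) 3 (+ suc j)
  ≡⟨ cong (λ n → C (suc n) 3 (+ suc j)) (+-suc m j) ⟩
    C (2 + (m + j)) 3 (+ suc j)
  ∎
  where open ℤᵖ.≤-Reasoning

-- Left endpoint: C_{3,1} = ±(p₂ − p₁) ≥ p₁ − p₂ = C_{3,n}, as p₁ ≤ p₂ for n ≥ 14.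
C-first-bound : ∀ n → 14 ≤ n → C (2 + n) 3 (+ n) ℤ.≤ C (2 + n) 3 (+ 1)
C-first-bound (suc i) (s≤s 13≤i) = begin
  C (3 + i) 3 (+ suc i)                                     ≡⟨ C-last (suc i) ⟩
  + w₁ (rising (suc i)) ℤ.- + w₂ (rising (suc i))           ≤⟨ sign-bound (suc i) (ℤ.+≤+ p₁≤p₂) ⟩
  sign (suc i) ℤ.* (+ w₂ (rising (suc i)) ℤ.- + w₁ (rising (suc i))) ≡⟨ C-first (suc i) ⟨
  C (3 + i) 3 (+ 1)                                         ∎
  where
  open ℤᵖ.≤-Reasoning
  p₁≤p₂ : w₁ (rising (suc i)) ≤ w₂ (rising (suc i))
  p₁≤p₂ = spread⇒≤ i (rising (suc i)) (spread-rising 13≤i)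

M-large : ∀ n → 15 ≤ n → M 3 (2 + n) ≡ C (2 + n) 3 (+ n)
M-large n 15≤n = minC-attained (2 + n) 3 n n (≤-trans (s≤s z≤n) 15≤n) ≤-refl below
  where
  below : ∀ i → 1 ≤ i → i ≤ n → C (2 + n) 3 (+ n) ℤ.≤ C (2 + n) 3 (+ i)
  below (suc zero)    _ _   = C-first-bound n (≤-trans (n≤1+n 14) 15≤n)
  below (suc (suc j)) _ i≤n with m≤n⇒m<n∨m≡n i≤n
  ... | inj₂ i≡n = ℤᵖ.≤-reflexive (cong (λ i → C (2 + n) 3 (+ i)) (sym i≡n))
  ... | inj₁ i<n =
    subst (λ n → C (2 + n) 3 (+ n) ℤ.≤ C (2 + n) 3 (+ suc (suc j))) m+j≡n
          (C-interior (suc j) m (s≤s z≤n) 2≤m (subst (15 ≤_) (sym m+j≡n) 15≤n))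
    where
    m = n ∸ suc j
    m+j≡n : m + suc j ≡ n
    m+j≡n = m∸n+n≡m (≤-trans (n≤1+n (suc j)) (<⇒≤ i<n))
    2≤m : 2 ≤ m
    2≤m = ≤-trans (≤-reflexive (sym (m+n∸n≡m 2 (suc j)))) (∸-monoˡ-≤ (suc j) i<n)

minimisesᵇ : ℕ → ℕ → ℕ → ℕ → Bool
minimisesᵇ d r zero    j = true
minimisesᵇ d r (suc L) j = (C d r (+ j) ℤ.≤ᵇ C d r (+ suc L)) ∧ minimisesᵇ d r L j

minimisesᵇ-sound : ∀ d r L j → T (minimisesᵇ d r L j) →
  ∀ i → 1 ≤ i → i ≤ L → C d r (+ j) ℤ.≤ C d r (+ i)
minimisesᵇ-sound d r zero    j _     (suc i) _ ()
minimisesᵇ-sound d r (suc L) j check with Equivalence.to T-∧ check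
... | top , rest = extend (minimisesᵇ-sound d r L j rest) (ℤᵖ.≤ᵇ⇒≤ top)

minC-by-evaluation : ∀ d r L j → 1 ≤ j → j ≤ L → T (minimisesᵇ d r L j) → minC d r L ≡ C d r (+ j)
minC-by-evaluation d r L j 1≤j j≤L check =
  minC-attained d r L j 1≤j j≤L (minimisesᵇ-sound d r L j check)

M-small-low : ∀ d → 6 ≤ d → d ≤ 9 → M 3 d ≡ C d 3 (+ (d ∸ 3))
M-small-low d 6≤d d≤9 = subst (λ d → M 3 d ≡ C d 3 (+ (d ∸ 3))) (m+[n∸m]≡n 6≤d)
  (minC-by-evaluation (6 + k) 3 (4 + k) (3 + k) (s≤s z≤n) (n≤1+n _) (table (s≤s (∸-monoˡ-≤ 6 d≤9))))
  where
  k = d ∸ 6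
  table : ∀ {k} → k < 4 → T (minimisesᵇ (6 + k) 3 (4 + k) (3 + k))
  table = toWitness {a? = allUpTo? (λ k → T? (minimisesᵇ (6 + k) 3 (4 + k) (3 + k))) 4} _

M-small-high : ∀ d → 10 ≤ d → d ≤ 16 → M 3 d ≡ C d 3 (+ (d ∸ 2))
M-small-high d 10≤d d≤16 = subst (λ d → M 3 d ≡ C d 3 (+ (d ∸ 2))) (m+[n∸m]≡n 10≤d)
  (minC-by-evaluation (10 + k) 3 (8 + k) (8 + k) (s≤s z≤n) ≤-refl (table (s≤s (∸-monoˡ-≤ 10 d≤16))))
  where
  k = d ∸ 10
  table : ∀ {k} → k < 7 → T (minimisesᵇ (10 + k) 3 (8 + k) (8 + k))
  table = toWitness {a? = allUpTo? (λ k → T? (minimisesᵇ (10 + k) 3 (8 + k) (8 + k))) 7} _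

M-from-10 : ∀ d → 10 ≤ d → M 3 d ≡ C d 3 (+ (d ∸ 2))
M-from-10 d 10≤d with d ≤? 16
... | yes d≤16 = M-small-high d 10≤d d≤16
... | no  d≰16 = subst (λ d → M 3 d ≡ C d 3 (+ (d ∸ 2))) (m+[n∸m]≡n (≤-trans (s≤s (s≤s z≤n)) 10≤d))
                      (M-large (d ∸ 2) (∸-monoˡ-≤ 2 (≰⇒> d≰16)))

lemma1p4 : (d : ℕ) → 6 ≤ d →
    (d ≤ 9 → M 3 d ≡ C d 3 (+ (d ∸ 3))) × (10 ≤ d → M 3 d ≡ C d 3 (+ (d ∸ 2)))
lemma1p4 d 6≤d = M-small-low d 6≤d , M-from-10 d
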